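{- Run the decomposition algorithm with $d=2$ and let $\mathrm{RS}[1],\dots,\mathrm{RS}[h]$ be the resulting lists of refined segments, $\mathrm{RS}[c][\ell]$ denoting the $\ell$-th segment of $\mathrm{RS}[c]$. Let $I$ be the array obtained by scanning $j=1,\dots,m$ and, for each $j$, $c=1,\dots,h$, appending $c$ to $I$ whenever $j$ is the right endpoint of some refined segment in $\mathrm{RS}[c]$. Fix a site $j$, a haplotype index $i$ and $\kappa\ge 0$ such that $c_\kappa=\phi^\kappa_j(i)\ge 1$ and $c_{\kappa+1}=\phi^{\kappa+1}_j(i)\ge 1$ (with $\phi^0_j(i)=i$). Let $\ell_\kappa$ be the index such that $\mathrm{RS}[c_\kappa][\ell_\kappa]$ contains $j$, and let $e_{c_\kappa}$ be the right endpoint of $\mathrm{RS}[c_\kappa][\ell_\kappa]$. Let $x$ be the position of the $\ell_\kappa$-th occurrence of $c_\kappa$ in $I$, and let $\rho=\mathrm{rank}_{c_{\kappa+1}}(I,x)$ be the number of occurrences of $c_{\kappa+1}$ in $I[1..x]$. Then either the $\rho$-th or the $(1+\rho)$-th refined segment in $\mathrm{RS}[c_{\kappa+1}]$ contains $e_{c_\kappa}$.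
   Context: Setting: haplotypes $S_1,\dots,S_h$ of length $m$; prefix array $\mathrm{PA}$ ($h\times m$, column $1$ is $1,\dots,h$, column $j>1$ sorts indices by co-lexicographic order of $S_i[1..j-1]$, ties broken stably); PBWT with $\mathrm{col}_j(\mathrm{PBWT})[x]=S_{\mathrm{col}_j(\mathrm{PA})[x]}[j]$; $(x,j)$ is a run-top if $x=1$ or $\mathrm{col}_j(\mathrm{PBWT})[x]\ne\mathrm{col}_j(\mathrm{PBWT})[x-1]$. For $\mathrm{col}_j(\mathrm{PA})[x]=i$: $\phi_j(i)=0$ if $x=1$, else $\phi_j(i)=\mathrm{col}_j(\mathrm{PA})[x-1]$; $\phi^{k}_j(i)=\phi_j(\phi^{k-1}_j(i))$. Haplotype intervals of $S_i$: with $b_1<\dots<b_k=m$ the set of $m$ and all columns $j$ such that some run-top $(x,j)$ has $\mathrm{col}_j(\mathrm{PA})[x]=i$, they are $[1,b_1],[b_1+1,b_2],\dots,[b_{k-1}+1,b_k]$. Two intervals overlap if they share an integer. Decomposition algorithm with integer parameter $d>1$: initially, for each $c$, $L_c$ is the linked list of haplotype intervals of $S_c$ in increasing order and $\mathrm{RS}[c]$ is empty. For $j=1,\dots,m$ and, within each $j$, for $i=1,\dots,h$: let $c=\mathrm{col}_j(\mathrm{PA})[i]$ and let $[b_c,e_c]$ be the first interval of $L_c$. If $j=e_c$, remove $[b_c,e_c]$ from $L_c$ and append it to the tail of $\mathrm{RS}[c]$. Otherwise, if $i>1$ and $[b_c,j]$ overlaps exactly $d$ refined segments currently in $\mathrm{RS}[c']$,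 where $c'=\mathrm{col}_j(\mathrm{PA})[i-1]$, append $[b_c,j]$ to $\mathrm{RS}[c]$ and replace the head $[b_c,e_c]$ of $L_c$ by $[j+1,e_c]$. At termination each $\mathrm{RS}[c]$ is a list of intervals partitioning $[1,m]$, in increasing order. -}

module Defs where

open import Data.Nat using (ℕ; zero; suc; _∸_; _≡ᵇ_; _<ᵇ_; _≤ᵇ_)
open import Data.Bool using (Bool; true; false; if_then_else_; _∧_; _∨_; not)
open import Data.List using (List; []; _∷_; _++_; [_]; foldl; map; upTo; filterᵇ; length; take; concatMap)
open import Data.Bool.ListAction using (any)
open import Data.Maybe using (Maybe; just; nothing)
import Data.Maybe as Maybe
open import Data.Product using (_×_; _,_; proj₁; proj₂)

-- Haplotypes: S i j is S_i[j] (1-based i ∈ [1,h], j ∈ [1,m]); values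
-- outside that range are never inspected.  Alphabet: ℕ.
Haplotypes : Set
Haplotypes = ℕ → ℕ → ℕ

range1 : ℕ → List ℕ
range1 n = map suc (upTo n)

nth0 : {A : Set} → List A → ℕ → Maybe A
nth0 []       _       = nothing
nth0 (x ∷ xs) zero    = just x
nth0 (x ∷ xs) (suc n) = nth0 xs n

nth1 : {A : Set} → List A → ℕ → Maybe A
nth1 xs zero    = nothing
nth1 xs (suc n) = nth0 xs n

colexLt : Haplotypes → ℕ → ℕ → ℕ → Bool
colexLt S zero    a b = false
colexLt S (suc k) a b =
  if S a (suc k) <ᵇ S b (suc k) then true
  else if S b (suc k) <ᵇ S a (suc k) then false
  else colexLt S k a b

insertBy : (ℕ → ℕ → Bool) → ℕ → List ℕ → List ℕ
insertBy lt x []       = x ∷ []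
insertBy lt x (y ∷ ys) = if lt x y then x ∷ y ∷ ys else y ∷ insertBy lt x ys

-- col_j(PA) as a list: indices 1..h stably sorted by co-lex order of S_i[1..j-1]
PAcol : Haplotypes → ℕ → ℕ → List ℕ
PAcol S h j = foldl (λ acc x → insertBy (colexLt S (j ∸ 1)) x acc) [] (range1 h)

fromMaybe0 : Maybe ℕ → ℕ
fromMaybe0 (just n) = n
fromMaybe0 nothing  = 0

-- col_j(PA)[x]  (0 if x out of range)
PA : Haplotypes → ℕ → ℕ → ℕ → ℕ
PA S h j x = fromMaybe0 (nth1 (PAcol S h j) x)

PBWT : Haplotypes → ℕ → ℕ → ℕ → ℕ
PBWT S h j x = S (PA S h j x) j

isRunTop : Haplotypes → ℕ → ℕ → ℕ → Bool
isRunTop S h x j = (x ≡ᵇ 1) ∨ not (PBWT S h j x ≡ᵇ PBWT S h j (x ∸ 1))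

-- the row x with col_j(PA)[x] = i (0 if none)
firstMatch : (ℕ → Bool) → List ℕ → ℕ
firstMatch p []       = 0
firstMatch p (x ∷ xs) = if p x then x else firstMatch p xs

posInCol : Haplotypes → ℕ → ℕ → ℕ → ℕ
posInCol S h j i = firstMatch (λ x → PA S h j x ≡ᵇ i) (range1 h)

-- φ_j(i); by convention φ_j(0) = 0
phi : Haplotypes → ℕ → ℕ → ℕ → ℕ
phi S h j i with posInCol S h j i
... | zero        = 0
... | suc zero    = 0
... | suc (suc y) = PA S h j (suc y)

phiIter : Haplotypes → ℕ → ℕ → ℕ → ℕ → ℕ
phiIter S h j zero    i = i
phiIter S h j (suc k) i = phi S h j (phiIter S h j k i)

-- Intervals are pairs (b , e) meaning [b, e].
Interval : Set
Interval = ℕ × ℕ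

isBreak : Haplotypes → ℕ → ℕ → ℕ → ℕ → Bool
isBreak S h m i j = (j ≡ᵇ m) ∨ any (λ x → isRunTop S h x j ∧ (PA S h j x ≡ᵇ i)) (range1 h)

mkIntervals : ℕ → List ℕ → List Interval
mkIntervals start []       = []
mkIntervals start (b ∷ bs) = (start , b) ∷ mkIntervals (suc b) bs

hapIntervals : Haplotypes → ℕ → ℕ → ℕ → List Interval
hapIntervals S h m i = mkIntervals 1 (filterᵇ (isBreak S h m i) (range1 m))

overlapsᵇ : Interval → Interval → Bool
overlapsᵇ (b , e) (b' , e') = (b ≤ᵇ e') ∧ (b' ≤ᵇ e)

countOverlaps : Interval → List Interval → ℕ
countOverlaps seg xs = length (filterᵇ (overlapsᵇ seg) xs)

update : {A : Set} → (ℕ → A) → ℕ → A → ℕ → A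
update f c v c' = if c' ≡ᵇ c then v else f c'

-- algorithm state: (L, RS)
State : Set
State = (ℕ → List Interval) × (ℕ → List Interval)

stepWith : ℕ → ℕ → ℕ → ℕ → ℕ → State → List Interval → State
stepWith d j i c c' st [] = st
stepWith d j i c c' (L , RS) ((b , e) ∷ rest) =
  if j ≡ᵇ e then (update L c rest , update RS c (RS c ++ [ (b , e) ]))
  else if (1 <ᵇ i) ∧ (countOverlaps (b , j) (RS c') ≡ᵇ d)
       then (update L c ((suc j , e) ∷ rest) , update RS c (RS c ++ [ (b , j) ]))
       else (L , RS)

step : Haplotypes → ℕ → ℕ → ℕ → State → ℕ → State
step S h d j st i =
  stepWith d j i (PA S h j i) (PA S h j (i ∸ 1)) st (proj₁ st (PA S h j i))

initState : Haplotypes → ℕ → ℕ → State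
initState S h m = (λ c → hapIntervals S h m c) , (λ c → [])

runAlgorithm : Haplotypes → ℕ → ℕ → ℕ → State
runAlgorithm S h m d =
  foldl (λ st j → foldl (step S h d j) st (range1 h)) (initState S h m) (range1 m)

RSfinal : Haplotypes → ℕ → ℕ → ℕ → ℕ → List Interval
RSfinal S h m d = proj₂ (runAlgorithm S h m d)

Iarray : Haplotypes → ℕ → ℕ → ℕ → List ℕ
Iarray S h m d =
  concatMap (λ j → filterᵇ (λ c → any (λ seg → proj₂ seg ≡ᵇ j) (RSfinal S h m d c)) (range1 h))
            (range1 m)

occPos : ℕ → ℕ → List ℕ → Maybe ℕ
occPos c ℓ []       = nothing
occPos c ℓ (y ∷ ys) =
  if y ≡ᵇ c then (if ℓ ≡ᵇ 1 then just 1 else Maybe.map suc (occPos c (ℓ ∸ 1) ys))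
  else Maybe.map suc (occPos c ℓ ys)

rank : ℕ → List ℕ → ℕ → ℕ
rank c xs x = length (filterᵇ (λ y → y ≡ᵇ c) (take x xs))

-- Every list RS[c] produced by the algorithm partitions [1, m] into consecutive
-- segments: the head of L_c always contains the current site j, and c is visited
-- exactly once in column j (col_j(PA) is a permutation of 1, …, h), where that
-- head is moved to RS[c] (if it ends at j), split at j, or kept.  In such a
-- partition the segment containing a site t has index 1 + #(segments ending
-- before t).  The array I lists, site by site and in increasing order, the
-- haplotypes having a segment ending there; hence the ℓ-th occurrence of c lies
-- in the block of e = e_c, and up to it I contains one c' per segment of RS[c']
-- ending before e, plus possibly one more (c' ≤ c ending at e).  So
-- rank_{c'}(I, x) is the index of the segment of RS[c'] containing e, or one
-- less.

{-# OPTIONS --safe #-}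
module Submission where

open import Defs
open import Data.Bool using (Bool; true; false; T; _∨_; _∧_)
open import Data.Bool.ListAction using (any)
open import Data.Bool.Properties using (T-∨)
open import Data.Empty using (⊥-elim)
open import Data.List using (List; []; _∷_; _++_; [_]; _∷ʳ_; foldl; map; upTo; applyUpTo; filterᵇ; length; take; concatMap)
open import Data.List.Properties
  using (filter-accept; filter-reject; filter-++; filter-none; filter-≐; length-++; length-map; length-upTo;
         ++-assoc; ++-identityʳ; concatMap-++; foldl-∷ʳ; map-++; map-∘; map-upTo; upTo-∷ʳ)
open import Data.List.Relation.Unary.All using (All; []; _∷_; universal)
open import Data.List.Relation.Unary.All.Properties using (applyUpTo⁺₁; map⁻)
open import Data.List.Relation.Unary.Linked using (Linked; [-]; _∷_)
open import Data.List.Relation.Unary.Linked.Properties using (applyUpTo⁺₂; ∷-filter⁺)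
open import Data.List.Relation.Binary.Permutation.Propositional
  using (_↭_; ↭-refl; ↭-trans; ↭-sym; ↭-reflexive; prep; swap)
open import Data.List.Relation.Binary.Permutation.Propositional.Properties
  using (↭-length; filter-↭; All-resp-↭; ++⁺ˡ; shift)
open import Data.Maybe using (just)
import Data.Maybe as Maybe
open import Data.Maybe.Properties using (just-injective)
open import Data.Nat using (ℕ; zero; suc; _+_; _∸_; _≤_; _<_; z≤n; s≤s; _≡ᵇ_; _≤ᵇ_; _<ᵇ_)
open import Data.Nat.Properties
open import Data.Product using (Σ; ∃; ∃₂; _×_; _,_; proj₁; proj₂)
open import Data.Sum using (_⊎_; inj₁; inj₂; [_,_]′)
open import Data.Unit using (⊤; tt)
open import Function using (_∘_; id)
open import Function.Bundles using (Equivalence)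
open import Relation.Nullary using (¬_; yes; no; contradiction)
open import Relation.Nullary.Decidable using (T?)
open import Relation.Binary.PropositionalEquality
  using (_≡_; _≢_; refl; sym; trans; cong; cong₂; subst; subst₂; module ≡-Reasoning)

open ≡-Reasoning

private
  variable
    A : Set
    b c c' d e j k m n s y : ℕ
    p : A → Bool

-- Occurrences, ranks and the ranges 1, …, n

occurrences : ℕ → List ℕ → ℕ
occurrences c xs = length (filterᵇ (_≡ᵇ c) xs)

occurrences-here : ∀ c xs → occurrences c (c ∷ xs) ≡ suc (occurrences c xs)
occurrences-here c xs with c ≡ᵇ c | ≡⇒≡ᵇ c c refl
... | true | _ = refl

occurrences-there : y ≢ c → ∀ xs → occurrences c (y ∷ xs) ≡ occurrences c xs
occurrences-there {y} {c} y≢c xs with y ≡ᵇ c | ≡ᵇ⇒≡ y c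
... | false | _   = refl
... | true  | y≡c = contradiction (y≡c tt) y≢c

occurrences-++ : ∀ xs ys → occurrences c (xs ++ ys) ≡ occurrences c xs + occurrences c ys
occurrences-++ {c} xs ys =
  trans (cong length (filter-++ (T? ∘ (_≡ᵇ c)) xs ys)) (length-++ (filterᵇ (_≡ᵇ c) xs))

occurrences-none : ∀ xs → occurrences c xs ≡ 0 → All (_≢ c) xs
occurrences-none []       _    = []
occurrences-none {c} (y ∷ xs) none with y ≟ c
... | yes refl = contradiction (trans (sym (occurrences-here c xs)) none) λ ()
... | no  y≢c  = y≢c ∷ occurrences-none xs (trans (sym (occurrences-there y≢c xs)) none)

occurrences-↭ : ∀ {xs ys} → xs ↭ ys → occurrences c xs ≡ occurrences c ys
occurrences-↭ {c} xs↭ys = ↭-length (filter-↭ (T? ∘ (_≡ᵇ c)) xs↭ys)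

occurrences-filterᵇ-accept : T (p c) → ∀ xs → occurrences c (filterᵇ p xs) ≡ occurrences c xs
occurrences-filterᵇ-accept pc [] = refl
occurrences-filterᵇ-accept {p = p} {c} pc (y ∷ xs) with p y in py
... | true with y ≡ᵇ c
...   | true  = cong suc (occurrences-filterᵇ-accept pc xs)
...   | false = occurrences-filterᵇ-accept pc xs
occurrences-filterᵇ-accept {p = p} {c} pc (y ∷ xs) | false with y ≡ᵇ c | ≡ᵇ⇒≡ y c
...   | false | _   = occurrences-filterᵇ-accept pc xs
...   | true  | y≡c = ⊥-elim (subst T py (subst (T ∘ p) (sym (y≡c tt)) pc))

occurrences-filterᵇ-reject : ¬ T (p c) → ∀ xs → occurrences c (filterᵇ p xs) ≡ 0
occurrences-filterᵇ-reject ¬pc [] = refl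
occurrences-filterᵇ-reject {p = p} {c} ¬pc (y ∷ xs) with p y in py
... | false = occurrences-filterᵇ-reject ¬pc xs
... | true with y ≡ᵇ c | ≡ᵇ⇒≡ y c
...   | false | _   = occurrences-filterᵇ-reject ¬pc xs
...   | true  | y≡c = contradiction (subst (T ∘ p) (y≡c tt) (subst T (sym py) tt)) ¬pc

occurrences-filterᵇ-≤ : ∀ c (p : ℕ → Bool) xs → occurrences c (filterᵇ p xs) ≤ occurrences c xs
occurrences-filterᵇ-≤ c p xs with T? (p c)
... | yes pc = ≤-reflexive (occurrences-filterᵇ-accept pc xs)
... | no ¬pc = ≤-trans (≤-reflexive (occurrences-filterᵇ-reject ¬pc xs)) z≤n

filterᵇ-++-∷ : ∀ (p : A → Bool) xs {y} ys → T (p y) → filterᵇ p (xs ++ y ∷ ys) ≡ filterᵇ p xs ++ y ∷ filterᵇ p ys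
filterᵇ-++-∷ p xs {y} ys py =
  trans (filter-++ (T? ∘ p) xs (y ∷ ys)) (cong (filterᵇ p xs ++_) (filter-accept (T? ∘ p) {y} {ys} py))

length-filterᵇ-∨ : ∀ (p q : A → Bool) → (∀ x → T (p x) → ¬ T (q x)) →
  ∀ xs → length (filterᵇ (λ x → p x ∨ q x) xs) ≡ length (filterᵇ p xs) + length (filterᵇ q xs)
length-filterᵇ-∨ p q disjoint [] = refl
length-filterᵇ-∨ p q disjoint (x ∷ xs) with p x in px | q x in qx
... | true  | true  = contradiction (subst T (sym qx) tt) (disjoint x (subst T (sym px) tt))
... | true  | false = cong suc (length-filterᵇ-∨ p q disjoint xs)
... | false | true  = trans (cong suc (length-filterᵇ-∨ p q disjoint xs)) (sym (+-suc _ _))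
... | false | false = length-filterᵇ-∨ p q disjoint xs

length-filterᵇ-≡ᵇ : ∀ c xs → length (filterᵇ (c ≡ᵇ_) xs) ≡ occurrences c xs
length-filterᵇ-≡ᵇ c xs =
  cong length (filter-≐ (T? ∘ (c ≡ᵇ_)) (T? ∘ (_≡ᵇ c)) ((λ {x} → flip c x) , (λ {x} → flip x c)) xs)
  where
  flip : ∀ a b → T (a ≡ᵇ b) → T (b ≡ᵇ a)
  flip a b a≡b = ≡⇒≡ᵇ b a (sym (≡ᵇ⇒≡ a b a≡b))

+-≤1 : ∀ a {t} → t ≤ 1 → a + t ≡ a ⊎ a + t ≡ suc a
+-≤1 a z≤n       = inj₁ (+-identityʳ a)
+-≤1 a (s≤s z≤n) = inj₂ (+-comm a 1)

range1-suc : ∀ n → range1 (suc n) ≡ range1 n ∷ʳ suc n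
range1-suc n = trans (cong (map suc) (sym (upTo-∷ʳ n))) (map-++ suc (upTo n) [ n ])

range1-split : c < n → ∃ λ rest → range1 n ≡ range1 c ++ suc c ∷ rest
range1-split {c} {suc n} c<1+n with m<1+n⇒m<n∨m≡n c<1+n
... | inj₂ refl = [] , range1-suc c
... | inj₁ c<n  with range1-split c<n
...   | rest , range1-n = rest ∷ʳ suc n , (begin
  range1 (suc n)                       ≡⟨ range1-suc n ⟩
  range1 n ∷ʳ suc n                    ≡⟨ cong (_∷ʳ suc n) range1-n ⟩
  (range1 c ++ suc c ∷ rest) ∷ʳ suc n  ≡⟨ ++-assoc (range1 c) (suc c ∷ rest) [ suc n ] ⟩
  range1 c ++ suc c ∷ rest ∷ʳ suc n    ∎)

range1-bounded : ∀ n → All (_≤ n) (range1 n)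
range1-bounded n = subst (All (_≤ n)) (sym (map-upTo suc n)) (applyUpTo⁺₁ suc n id)

range1-linked : ∀ n → Linked _<_ (0 ∷ range1 n)
range1-linked n = subst (Linked _<_ ∘ (0 ∷_)) (sym (map-upTo suc n)) (applyUpTo⁺₂ id (suc n) n<1+n)

occurrences-range1-suc : ∀ n → occurrences c (range1 (suc n)) ≡ occurrences c (range1 n) + occurrences c [ suc n ]
occurrences-range1-suc {c} n = trans (cong (occurrences c) (range1-suc n)) (occurrences-++ (range1 n) [ suc n ])

occurrences-range1-out : n < c → occurrences c (range1 n) ≡ 0
occurrences-range1-out {zero}  _   = refl
occurrences-range1-out {suc n} n<c = trans (occurrences-range1-suc n)
  (cong₂ _+_ (occurrences-range1-out (<-trans (n<1+n n) n<c)) (occurrences-there (<⇒≢ n<c) []))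

occurrences-range1-in : 1 ≤ c → c ≤ n → occurrences c (range1 n) ≡ 1
occurrences-range1-in {n = zero}  1≤c z≤n = contradiction 1≤c λ ()
occurrences-range1-in {c} {suc n} 1≤c c≤1+n with c ≟ suc n
... | yes refl = trans (occurrences-range1-suc n)
  (cong₂ _+_ (occurrences-range1-out (n<1+n n)) (occurrences-here c []))
... | no c≢1+n = trans (occurrences-range1-suc n)
  (cong₂ _+_ (occurrences-range1-in 1≤c (≤-pred (≤∧≢⇒< c≤1+n c≢1+n))) (occurrences-there (c≢1+n ∘ sym) []))

occurrences-range1-≤1 : 1 ≤ c → ∀ n → occurrences c (range1 n) ≤ 1
occurrences-range1-≤1 {c} 1≤c n with c ≤? n
... | yes c≤n = ≤-reflexive (occurrences-range1-in 1≤c c≤n)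
... | no  c≰n = ≤-trans (≤-reflexive (occurrences-range1-out (≰⇒> c≰n))) z≤n

occPos-at : ∀ c pre post → occPos c (suc (occurrences c pre)) (pre ++ c ∷ post) ≡ just (suc (length pre))
occPos-at c [] post with c ≡ᵇ c | ≡⇒≡ᵇ c c refl
... | true | _ = refl
occPos-at c (y ∷ pre) post with y ≡ᵇ c
... | true  = cong (Maybe.map suc) (occPos-at c pre post)
... | false = cong (Maybe.map suc) (occPos-at c pre post)

take-at : ∀ (pre : List A) y post → take (suc (length pre)) (pre ++ y ∷ post) ≡ pre ∷ʳ y
take-at []        y post = refl
take-at (x ∷ pre) y post = cong (x ∷_) (take-at pre y post)

rank-at-occPos : ∀ {x} pre post → occPos c (suc (occurrences c pre)) (pre ++ c ∷ post) ≡ just x →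
  rank c' (pre ++ c ∷ post) x ≡ occurrences c' (pre ∷ʳ c)
rank-at-occPos {c} {c'} pre post occ≡ with just-injective (trans (sym occ≡) (occPos-at c pre post))
... | refl = cong (occurrences c') (take-at pre c post)

-- Partitions of an interval into consecutive segments

data Partition : ℕ → ℕ → List Interval → Set where
  []  : ∀ {m} → Partition (suc m) m []
  _∷_ : ∀ {s e m R} → s ≤ e → Partition (suc e) m R → Partition s m ((s , e) ∷ R)

endsAt : List Interval → ℕ → Bool
endsAt R k = any (λ seg → proj₂ seg ≡ᵇ k) R

countEndSites : List Interval → ℕ → ℕ
countEndSites R n = length (filterᵇ (endsAt R) (range1 n))

endsBy : ℕ → Interval → Bool
endsBy n seg = proj₂ seg ≤ᵇ n

endedBy : ℕ → List Interval → ℕ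
endedBy n R = length (filterᵇ (endsBy n) R)

SegmentContains : List Interval → ℕ → ℕ → Set
SegmentContains R ℓ t = Σ Interval λ seg → nth1 R ℓ ≡ just seg × proj₁ seg ≤ t × t ≤ proj₂ seg

nth0-endsAt : ∀ R p → nth0 R p ≡ just (b , e) → T (endsAt R e)
nth0-endsAt ((_ , e) ∷ R)  zero    refl = Equivalence.from (T-∨ {e ≡ᵇ e} {endsAt R e}) (inj₁ (≡⇒≡ᵇ e e refl))
nth0-endsAt ((_ , e') ∷ R) (suc p) seg≡ = Equivalence.from (T-∨ {e' ≡ᵇ _} {endsAt R _}) (inj₂ (nth0-endsAt R p seg≡))

endedBy-∷-≤ : ∀ b R → e ≤ n → endedBy n ((b , e) ∷ R) ≡ suc (endedBy n R)
endedBy-∷-≤ {e} {n} b R e≤n = cong length (filter-accept (T? ∘ endsBy n) {b , e} {R} (≤⇒≤ᵇ e≤n))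

endedBy-∷-> : ∀ b R → n < e → endedBy n ((b , e) ∷ R) ≡ endedBy n R
endedBy-∷-> {n} {e} b R n<e = cong length (filter-reject (T? ∘ endsBy n) {b , e} {R} (<⇒≱ n<e ∘ ≤ᵇ⇒≤ e n))

endedBy-∷ : ∀ b R → 1 ≤ e → endedBy n ((b , e) ∷ R) ≡ occurrences e (range1 n) + endedBy n R
endedBy-∷ {e} {n} b R 1≤e with e ≤? n
... | yes e≤n = trans (endedBy-∷-≤ b R e≤n) (cong (_+ endedBy n R) (sym (occurrences-range1-in 1≤e e≤n)))
... | no  e≰n = trans (endedBy-∷-> b R (≰⇒> e≰n)) (cong (_+ endedBy n R) (sym (occurrences-range1-out (≰⇒> e≰n))))

partition-start-≤ : ∀ {R} → Partition s m R → s ≤ suc m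
partition-start-≤ []        = ≤-refl
partition-start-≤ (s≤e ∷ P) = m≤n⇒m≤1+n (≤-trans s≤e (≤-pred (partition-start-≤ P)))

partition-segment : ∀ {R} p → Partition s m R → nth0 R p ≡ just (b , e) → s ≤ b × b ≤ e × e ≤ m
partition-segment zero    (s≤e ∷ P) refl = ≤-refl , s≤e , ≤-pred (partition-start-≤ P)
partition-segment (suc p) (s≤e ∷ P) seg≡ =
  let s'≤b , b≤e , e≤m = partition-segment p P seg≡ in ≤-trans s≤e (≤-trans (n≤1+n _) s'≤b) , b≤e , e≤m

partition-segment-end : ∀ {R} p → Partition s m R → nth0 R p ≡ just (b , e) → e ≤ m
partition-segment-end p P seg≡ = proj₂ (proj₂ (partition-segment p P seg≡))

partition-endedBy-below : ∀ {R} → Partition s m R → n < s → endedBy n R ≡ 0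
partition-endedBy-below []                      _   = refl
partition-endedBy-below (_∷_ {s} {R = R} s≤e P) n<s =
  trans (endedBy-∷-> s R (<-≤-trans n<s s≤e)) (partition-endedBy-below P (<-≤-trans n<s (m≤n⇒m≤1+n s≤e)))

partition-not-endsAt : ∀ {R} → Partition s m R → k < s → ¬ T (endsAt R k)
partition-not-endsAt []                          _   ()
partition-not-endsAt {k = k} (_∷_ {e = e} s≤e P) k<s k-end =
  [ (λ e≡k → <-irrefl (sym (≡ᵇ⇒≡ e k e≡k)) (<-≤-trans k<s s≤e))
  , partition-not-endsAt P (<-≤-trans k<s (m≤n⇒m≤1+n s≤e))
  ]′ (Equivalence.to T-∨ k-end)

partition-nth0-index : ∀ {R} p → Partition s m R → nth0 R p ≡ just (b , suc n) → p ≡ endedBy n R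
partition-nth0-index {n = n} zero (_∷_ {s} {R = R} _ P) refl =
  sym (trans (endedBy-∷-> s R (n<1+n n)) (partition-endedBy-below P (m≤n⇒m≤1+n (n<1+n n))))
partition-nth0-index (suc p) (_∷_ {s} {R = R} _ P) seg≡ with partition-segment p P seg≡
... | e<b , b≤1+n , _ =
  trans (cong suc (partition-nth0-index p P seg≡)) (sym (endedBy-∷-≤ s R (≤-pred (≤-trans e<b b≤1+n))))

partition-covers : ∀ {R} → Partition s m R → s ≤ suc n → suc n ≤ m → SegmentContains R (suc (endedBy n R)) (suc n)
partition-covers []                                  s≤1+n 1+n≤m = contradiction (≤-trans s≤1+n 1+n≤m) 1+n≰n
partition-covers {n = n} (_∷_ {s} {e} {R = R} s≤e P) s≤1+n 1+n≤m with e ≤? n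
... | yes e≤n = subst (λ ℓ → SegmentContains ((s , e) ∷ R) (suc ℓ) (suc n)) (sym (endedBy-∷-≤ s R e≤n))
                      (partition-covers P (s≤s e≤n) 1+n≤m)
... | no  e≰n = subst (λ ℓ → SegmentContains ((s , e) ∷ R) (suc ℓ) (suc n))
                      (sym (trans (endedBy-∷-> s R (≰⇒> e≰n)) (partition-endedBy-below P (m≤n⇒m≤1+n (≰⇒> e≰n)))))
                      ((s , e) , refl , s≤1+n , ≰⇒> e≰n)

partition-countEndSites : ∀ {R} → Partition (suc s) m R → ∀ n → countEndSites R n ≡ endedBy n R
partition-countEndSites [] n = cong length (filter-none (T? ∘ endsAt []) (universal (λ _ ()) (range1 n)))
partition-countEndSites (_∷_ {s} {e} {R = R} s≤e P) n = begin
  countEndSites ((s , e) ∷ R) n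
    ≡⟨ length-filterᵇ-∨ (e ≡ᵇ_) (endsAt R) e-not-in-R (range1 n) ⟩
  length (filterᵇ (e ≡ᵇ_) (range1 n)) + countEndSites R n
    ≡⟨ cong₂ _+_ (length-filterᵇ-≡ᵇ e (range1 n)) (partition-countEndSites P n) ⟩
  occurrences e (range1 n) + endedBy n R
    ≡⟨ endedBy-∷ s R (≤-trans (s≤s z≤n) s≤e) ⟨
  endedBy n ((s , e) ∷ R) ∎
  where
  e-not-in-R : ∀ k → T (e ≡ᵇ k) → ¬ T (endsAt R k)
  e-not-in-R k e≡k = partition-not-endsAt P (s≤s (≤-reflexive (sym (≡ᵇ⇒≡ e k e≡k))))

-- The array I of segment ends, for an arbitrary family RS

module _ (h : ℕ) (RS : ℕ → List Interval) where

  endpointsAt : ℕ → List ℕ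
  endpointsAt k = filterᵇ (λ c → endsAt (RS c) k) (range1 h)

  endpointArray : ℕ → List ℕ
  endpointArray m = concatMap endpointsAt (range1 m)

  occurrences-endpointsAt : 1 ≤ d → d ≤ h → ∀ k → occurrences d (endpointsAt k) ≡ length (filterᵇ (endsAt (RS d)) [ k ])
  occurrences-endpointsAt {d} 1≤d d≤h k with endsAt (RS d) k in d-ends
  ... | true  = trans (occurrences-filterᵇ-accept (subst T (sym d-ends) tt) (range1 h)) (occurrences-range1-in 1≤d d≤h)
  ... | false = occurrences-filterᵇ-reject (subst T d-ends) (range1 h)

  occurrences-endpoints : 1 ≤ d → d ≤ h → ∀ ks →
    occurrences d (concatMap endpointsAt ks) ≡ length (filterᵇ (endsAt (RS d)) ks)
  occurrences-endpoints 1≤d d≤h [] = refl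
  occurrences-endpoints {d} 1≤d d≤h (k ∷ ks) = begin
    occurrences d (endpointsAt k ++ concatMap endpointsAt ks)
      ≡⟨ occurrences-++ (endpointsAt k) _ ⟩
    occurrences d (endpointsAt k) + occurrences d (concatMap endpointsAt ks)
      ≡⟨ cong₂ _+_ (occurrences-endpointsAt 1≤d d≤h k) (occurrences-endpoints 1≤d d≤h ks) ⟩
    length (filterᵇ (endsAt (RS d)) [ k ]) + length (filterᵇ (endsAt (RS d)) ks)
      ≡⟨ length-++ (filterᵇ (endsAt (RS d)) [ k ]) ⟨
    length (filterᵇ (endsAt (RS d)) [ k ] ++ filterᵇ (endsAt (RS d)) ks)
      ≡⟨ cong length (filter-++ (T? ∘ endsAt (RS d)) [ k ] ks) ⟨
    length (filterᵇ (endsAt (RS d)) (k ∷ ks)) ∎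

  endpointArray-around : 1 ≤ c → c ≤ h → n < m → T (endsAt (RS c) (suc n)) →
    ∃₂ λ pre post → endpointArray m ≡ pre ++ c ∷ post
      × occurrences c pre ≡ countEndSites (RS c) n
      × (∀ {c'} → 1 ≤ c' → c' ≤ h →
           let E = countEndSites (RS c') n in occurrences c' (pre ∷ʳ c) ≡ E ⊎ occurrences c' (pre ∷ʳ c) ≡ suc E)
  endpointArray-around {c@(suc c₀)} {n} {m} _ c≤h n<m c-ends with range1-split n<m | range1-split c≤h
  ... | sites , sites≡ | rows , rows≡ = before ++ lower , post , array≡ , occurrences-c , occurrences-c'
    where
    P : ℕ → Bool
    P d = endsAt (RS d) (suc n)
    before : List ℕ
    before = concatMap endpointsAt (range1 n)

    lower : List ℕ
    lower = filterᵇ P (range1 c₀)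

    post : List ℕ
    post = filterᵇ P rows ++ concatMap endpointsAt sites

    array≡ : endpointArray m ≡ (before ++ lower) ++ c ∷ post
    array≡ = begin
      concatMap endpointsAt (range1 m)
        ≡⟨ cong (concatMap endpointsAt) sites≡ ⟩
      concatMap endpointsAt (range1 n ++ suc n ∷ sites)
        ≡⟨ concatMap-++ endpointsAt (range1 n) (suc n ∷ sites) ⟩
      before ++ filterᵇ P (range1 h) ++ concatMap endpointsAt sites
        ≡⟨ cong (λ block → before ++ block ++ concatMap endpointsAt sites)
                (trans (cong (filterᵇ P) rows≡) (filterᵇ-++-∷ P (range1 c₀) rows c-ends)) ⟩
      before ++ (lower ++ c ∷ filterᵇ P rows) ++ concatMap endpointsAt sites
        ≡⟨ cong (before ++_) (++-assoc lower (c ∷ filterᵇ P rows) _) ⟩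
      before ++ lower ++ c ∷ post
        ≡⟨ ++-assoc before lower (c ∷ post) ⟨
      (before ++ lower) ++ c ∷ post ∎

    occurrences-c : occurrences c (before ++ lower) ≡ countEndSites (RS c) n
    occurrences-c = begin
      occurrences c (before ++ lower)
        ≡⟨ occurrences-++ before lower ⟩
      occurrences c before + occurrences c lower
        ≡⟨ cong₂ _+_ (occurrences-endpoints (s≤s z≤n) c≤h (range1 n))
                     (n≤0⇒n≡0 (≤-trans (occurrences-filterᵇ-≤ c P (range1 c₀))
                                       (≤-reflexive (occurrences-range1-out (n<1+n c₀))))) ⟩
      countEndSites (RS c) n + 0
        ≡⟨ +-identityʳ _ ⟩
      countEndSites (RS c) n ∎

    occurrences-c' : ∀ {c'} → 1 ≤ c' → c' ≤ h →
      occurrences c' ((before ++ lower) ∷ʳ c) ≡ countEndSites (RS c') n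
      ⊎ occurrences c' ((before ++ lower) ∷ʳ c) ≡ suc (countEndSites (RS c') n)
    occurrences-c' {c'} 1≤c' c'≤h =
      subst (λ o → o ≡ countEndSites (RS c') n ⊎ o ≡ suc (countEndSites (RS c') n)) (sym count≡)
            (+-≤1 _ (≤-trans (occurrences-filterᵇ-≤ c' P (range1 c)) (occurrences-range1-≤1 1≤c' c)))
      where
      count≡ : occurrences c' ((before ++ lower) ∷ʳ c) ≡ countEndSites (RS c') n + occurrences c' (filterᵇ P (range1 c))
      count≡ = begin
        occurrences c' ((before ++ lower) ∷ʳ c)
          ≡⟨ cong (occurrences c') (++-assoc before lower [ c ]) ⟩
        occurrences c' (before ++ lower ∷ʳ c)
          ≡⟨ occurrences-++ before (lower ∷ʳ c) ⟩
        occurrences c' before + occurrences c' (lower ∷ʳ c)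
          ≡⟨ cong₂ _+_ (occurrences-endpoints 1≤c' c'≤h (range1 n))
                       (cong (occurrences c') (trans (sym (filterᵇ-++-∷ P (range1 c₀) [] c-ends))
                                                     (cong (filterᵇ P) (sym (range1-suc c₀))))) ⟩
        countEndSites (RS c') n + occurrences c' (filterᵇ P (range1 c)) ∎

  endpointArray-rank : ∀ {m c c' ℓ b e x} → 1 ≤ c → c ≤ h → 1 ≤ c' → c' ≤ h →
    Partition 1 m (RS c) → Partition 1 m (RS c') →
    nth1 (RS c) ℓ ≡ just (b , e) → 1 ≤ e →
    occPos c ℓ (endpointArray m) ≡ just x →
    SegmentContains (RS c') (rank c' (endpointArray m) x) e
      ⊎ SegmentContains (RS c') (suc (rank c' (endpointArray m) x)) e
  endpointArray-rank {ℓ = zero} _ _ _ _ _ _ () _ _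
  endpointArray-rank {e = zero} _ _ _ _ _ _ _ () _
  endpointArray-rank {m} {c} {c'} {suc p} {e = suc n} {x} 1≤c c≤h 1≤c' c'≤h Pc Pc' seg≡ _ occ≡
    with endpointArray-around 1≤c c≤h (partition-segment-end p Pc seg≡) (nth0-endsAt (RS c) p seg≡)
  ... | pre , post , array≡ , occurrences-c , occurrences-c' =
    [ (λ eq → inj₂ (located (cong suc (rank-is eq))))
    , (λ eq → inj₁ (located (rank-is eq)))
    ]′ (occurrences-c' 1≤c' c'≤h)
    where
    index≡ : p ≡ occurrences c pre
    index≡ = trans (partition-nth0-index p Pc seg≡) (trans (sym (partition-countEndSites Pc n)) (sym occurrences-c))

    rank-is : ∀ {r} → occurrences c' (pre ∷ʳ c) ≡ r → rank c' (endpointArray m) x ≡ r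
    rank-is = trans (trans (cong (λ I → rank c' I x) array≡)
                           (rank-at-occPos pre post (subst₂ (λ ℓ I → occPos c (suc ℓ) I ≡ just x) index≡ array≡ occ≡)))

    located : ∀ {r} → r ≡ suc (countEndSites (RS c') n) → SegmentContains (RS c') r (suc n)
    located r≡ = subst (λ r → SegmentContains (RS c') r (suc n))
                       (sym (trans r≡ (cong suc (partition-countEndSites Pc' n))))
                       (partition-covers Pc' (s≤s z≤n) (partition-segment-end p Pc seg≡))

-- Columns of the prefix array

insertBy-↭ : ∀ lt (x : ℕ) ys → insertBy lt x ys ↭ x ∷ ys
insertBy-↭ lt x []       = ↭-refl
insertBy-↭ lt x (y ∷ ys) with lt x y
... | true  = ↭-refl
... | false = ↭-trans (prep y (insertBy-↭ lt x ys)) (swap y x ↭-refl)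

foldl-insertBy-↭ : ∀ lt acc xs → foldl (λ acc x → insertBy lt x acc) acc xs ↭ xs ++ acc
foldl-insertBy-↭ lt acc []       = ↭-refl
foldl-insertBy-↭ lt acc (x ∷ xs) =
  ↭-trans (foldl-insertBy-↭ lt (insertBy lt x acc) xs) (↭-trans (++⁺ˡ xs (insertBy-↭ lt x acc)) (shift x xs acc))

applyUpTo-nth0 : ∀ xs → applyUpTo (fromMaybe0 ∘ nth0 xs) (length xs) ≡ xs
applyUpTo-nth0 []       = refl
applyUpTo-nth0 (x ∷ xs) = cong (x ∷_) (applyUpTo-nth0 xs)

All-fromMaybe0-nth0 : ∀ {P : ℕ → Set} {xs} → All P xs → P 0 → ∀ k → P (fromMaybe0 (nth0 xs k))
All-fromMaybe0-nth0 []        P0 k       = P0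
All-fromMaybe0-nth0 (Px ∷ _)  P0 zero    = Px
All-fromMaybe0-nth0 (_ ∷ Pxs) P0 (suc k) = All-fromMaybe0-nth0 Pxs P0 k

module _ (S : Haplotypes) (h j : ℕ) where

  PAcol-↭ : PAcol S h j ↭ range1 h
  PAcol-↭ = ↭-trans (foldl-insertBy-↭ _ [] (range1 h)) (↭-reflexive (++-identityʳ (range1 h)))

  PAcol-length : length (PAcol S h j) ≡ h
  PAcol-length = trans (↭-length PAcol-↭) (trans (length-map suc (upTo h)) (length-upTo h))

  map-PA-range1 : map (PA S h j) (range1 h) ≡ PAcol S h j
  map-PA-range1 = begin
    map (PA S h j) (map suc (upTo h))                  ≡⟨ map-∘ (upTo h) ⟨
    map (PA S h j ∘ suc) (upTo h)                      ≡⟨ map-upTo (PA S h j ∘ suc) h ⟩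
    applyUpTo (PA S h j ∘ suc) h                       ≡⟨ cong (applyUpTo (PA S h j ∘ suc)) PAcol-length ⟨
    applyUpTo (PA S h j ∘ suc) (length (PAcol S h j))  ≡⟨ applyUpTo-nth0 (PAcol S h j) ⟩
    PAcol S h j                                        ∎

  PA-occurs-once : 1 ≤ c → c ≤ h → occurrences c (map (PA S h j) (range1 h)) ≡ 1
  PA-occurs-once {c} 1≤c c≤h = begin
    occurrences c (map (PA S h j) (range1 h)) ≡⟨ cong (occurrences c) map-PA-range1 ⟩
    occurrences c (PAcol S h j)               ≡⟨ occurrences-↭ PAcol-↭ ⟩
    occurrences c (range1 h)                  ≡⟨ occurrences-range1-in 1≤c c≤h ⟩
    1                                         ∎

  PA-≤ : ∀ x → PA S h j x ≤ h
  PA-≤ zero    = z≤n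
  PA-≤ (suc x) = All-fromMaybe0-nth0 (All-resp-↭ (↭-sym PAcol-↭) (range1-bounded h)) z≤n x

  phi-≤ : ∀ i → phi S h j i ≤ h
  phi-≤ i with posInCol S h j i
  ... | zero        = z≤n
  ... | suc zero    = z≤n
  ... | suc (suc y) = PA-≤ (suc y)

  phiIter-≤ : ∀ k {i} → i ≤ h → phiIter S h j k i ≤ h
  phiIter-≤ zero    i≤h = i≤h
  phiIter-≤ (suc k) _   = phi-≤ _

-- The decomposition algorithm

mkIntervals-partition : ∀ bs → Linked _<_ (s ∷ bs ∷ʳ m) → Partition (suc s) m (mkIntervals (suc s) (bs ∷ʳ m))
mkIntervals-partition []       (s<m ∷ [-])    = s<m ∷ []
mkIntervals-partition (b ∷ bs) (s<b ∷ linked) = s<b ∷ mkIntervals-partition bs linked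

hapIntervals-partition : ∀ S h m c → Partition 1 m (hapIntervals S h m c)
hapIntervals-partition S h zero    c = []
hapIntervals-partition S h (suc n) c =
  subst (Partition 1 (suc n) ∘ mkIntervals 1) (sym breaks≡) (mkIntervals-partition (filterᵇ break? (range1 n)) linked)
  where
  break? : ℕ → Bool
  break? = isBreak S h (suc n) c

  breaks≡ : filterᵇ break? (range1 (suc n)) ≡ filterᵇ break? (range1 n) ∷ʳ suc n
  breaks≡ = trans (cong (filterᵇ break?) (range1-suc n))
                  (filterᵇ-++-∷ break? (range1 n) [] (Equivalence.from (T-∨ {suc n ≡ᵇ suc n}) (inj₁ (≡⇒≡ᵇ n n refl))))

  linked : Linked _<_ (0 ∷ filterᵇ break? (range1 n) ∷ʳ suc n)
  linked = subst (Linked _<_ ∘ (0 ∷_)) breaks≡ (∷-filter⁺ (T? ∘ break?) <-trans (range1-linked (suc n)))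

HeadContains : ℕ → List Interval → Set
HeadContains j []            = ⊤
HeadContains j ((b , e) ∷ _) = b ≤ j × j ≤ e

-- (L , R) stands for (L_c , RS[c]) just before column j is processed.
LoopInvariant : ℕ → ℕ → List Interval × List Interval → Set
LoopInvariant m j (L , R) = Partition 1 m (R ++ L) × HeadContains j L

partition-head : ∀ {L} → Partition s m L → HeadContains s L
partition-head []        = tt
partition-head (s≤e ∷ _) = ≤-refl , s≤e

partition-drop : ∀ R {L} → Partition s m (R ++ L) → ∃ λ s' → Partition s' m L
partition-drop []      P       = _ , P
partition-drop (_ ∷ R) (_ ∷ P) = partition-drop R P

partition-refine : ∀ R {L} → Partition s m (R ++ (b , e) ∷ L) → b ≤ j → j < e →
  Partition s m (R ++ (b , j) ∷ (suc j , e) ∷ L)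
partition-refine []      (_ ∷ P)   b≤j j<e = b≤j ∷ (j<e ∷ P)
partition-refine (_ ∷ R) (s≤e ∷ P) b≤j j<e = s≤e ∷ partition-refine R P b≤j j<e

invariant-move : ∀ {R L} → j ≡ e → LoopInvariant m j ((b , e) ∷ L , R) → LoopInvariant m (suc j) (L , R ++ [ (b , e) ])
invariant-move {m = m} {R = R} refl (P , _) with partition-drop R P
... | _ , (_ ∷ P') = subst (Partition 1 m) (sym (++-assoc R [ _ ] _)) P , partition-head P'

invariant-split : ∀ {R L} → j < e → LoopInvariant m j ((b , e) ∷ L , R) →
  LoopInvariant m (suc j) ((suc j , e) ∷ L , R ++ [ (b , j) ])
invariant-split {m = m} {R = R} j<e (P , b≤j , _) =
  subst (Partition 1 m) (sym (++-assoc R [ _ ] _)) (partition-refine R P b≤j j<e) , ≤-refl , j<e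

invariant-stay : ∀ {R L} → j ≢ e → LoopInvariant m j ((b , e) ∷ L , R) → LoopInvariant m (suc j) ((b , e) ∷ L , R)
invariant-stay j≢e (P , b≤j , j≤e) = P , m≤n⇒m≤1+n b≤j , ≤∧≢⇒< j≤e j≢e

invariant-final : ∀ {L R} → LoopInvariant m (suc m) (L , R) → Partition 1 m R
invariant-final {m} {[]}    {R} (P , _) = subst (Partition 1 m) (++-identityʳ R) P
invariant-final {m} {_ ∷ _} {R} (P , _ , 1+m≤e) with partition-drop R P
... | _ , (_ ∷ P') = contradiction (≤-trans 1+m≤e (≤-pred (partition-start-≤ P'))) 1+n≰n

at : ℕ → State → List Interval × List Interval
at c st = proj₁ st c , proj₂ st c

at-update-same : ∀ (L RS : ℕ → List Interval) c v w → at c (update L c v , update RS c w) ≡ (v , w)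
at-update-same L RS c v w with c ≡ᵇ c | ≡⇒≡ᵇ c c refl
... | true | _ = refl

at-update-other : ∀ (L RS : ℕ → List Interval) {c c₀} v w → c ≢ c₀ →
  at c (update L c₀ v , update RS c₀ w) ≡ at c (L , RS)
at-update-other L RS {c} {c₀} v w c≢c₀ with c ≡ᵇ c₀ | ≡ᵇ⇒≡ c c₀
... | false | _    = refl
... | true  | c≡c₀ = contradiction (c≡c₀ tt) c≢c₀

module _ {d j i c' : ℕ} (L RS : ℕ → List Interval) where

  stepWith-frame : ∀ {c c₀} Lc → c ≢ c₀ → at c (stepWith d j i c₀ c' (L , RS) Lc) ≡ at c (L , RS)
  stepWith-frame []               c≢c₀ = refl
  stepWith-frame ((b , e) ∷ rest) c≢c₀ with j ≡ᵇ e
  ... | true = at-update-other L RS _ _ c≢c₀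
  ... | false with (1 <ᵇ i) ∧ (countOverlaps (b , j) (RS c') ≡ᵇ d)
  ...   | true  = at-update-other L RS _ _ c≢c₀
  ...   | false = refl

  stepWith-preserves : ∀ {m c} Lc → L c ≡ Lc → LoopInvariant m j (Lc , RS c) →
    LoopInvariant m (suc j) (at c (stepWith d j i c c' (L , RS) Lc))
  stepWith-preserves {m} {c} [] L≡ (P , _) =
    subst (λ Lc → LoopInvariant m (suc j) (Lc , RS c)) (sym L≡) (P , tt)
  stepWith-preserves {m} {c} ((b , e) ∷ rest) L≡ inv with j ≡ᵇ e | ≡ᵇ⇒≡ j e | ≡⇒≡ᵇ j e
  ... | true  | j≡e | _ =
    subst (LoopInvariant m (suc j)) (sym (at-update-same L RS c _ _)) (invariant-move (j≡e tt) inv)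
  ... | false | _ | j≢e with (1 <ᵇ i) ∧ (countOverlaps (b , j) (RS c') ≡ᵇ d)
  ...   | true  = subst (LoopInvariant m (suc j)) (sym (at-update-same L RS c _ _))
                        (invariant-split (≤∧≢⇒< (proj₂ (proj₂ inv)) j≢e) inv)
  ...   | false = subst (λ Lc → LoopInvariant m (suc j) (Lc , RS c)) (sym L≡) (invariant-stay j≢e inv)

module _ (S : Haplotypes) (h m d : ℕ) where

  column-frame : ∀ {j c} is st → All (λ i → PA S h j i ≢ c) is → at c (foldl (step S h d j) st is) ≡ at c st
  column-frame     []       st []             = refl
  column-frame {j} (i ∷ is) st (PAi≢c ∷ rest) =
    trans (column-frame is _ rest)
          (stepWith-frame {d} {j} {i} {PA S h j (i ∸ 1)} (proj₁ st) (proj₂ st) (proj₁ st (PA S h j i)) (PAi≢c ∘ sym))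

  column-preserves : ∀ {j c} is st → occurrences c (map (PA S h j) is) ≡ 1 →
    LoopInvariant m j (at c st) → LoopInvariant m (suc j) (at c (foldl (step S h d j) st is))
  column-preserves {j} {c} (i ∷ is) st once inv with PA S h j i ≟ c
  ... | yes refl =
    subst (LoopInvariant m (suc j)) (sym (column-frame is _ (map⁻ (occurrences-none _ none-after))))
          (stepWith-preserves {d} {j} {i} {PA S h j (i ∸ 1)} (proj₁ st) (proj₂ st) (proj₁ st c) refl inv)
    where
    none-after : occurrences c (map (PA S h j) is) ≡ 0
    none-after = suc-injective (trans (sym (occurrences-here c _)) once)
  ... | no PAi≢c =
    column-preserves is _ (trans (sym (occurrences-there PAi≢c _)) once)
      (subst (LoopInvariant m j)
             (sym (stepWith-frame {d} {j} {i} {PA S h j (i ∸ 1)} (proj₁ st) (proj₂ st) (proj₁ st (PA S h j i)) (PAi≢c ∘ sym)))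
             inv)

  columns-preserve : 1 ≤ c → c ≤ h → ∀ n →
    LoopInvariant m (suc n) (at c (foldl (λ st j → foldl (step S h d j) st (range1 h)) (initState S h m) (range1 n)))
  columns-preserve {c} _ _ zero = hapIntervals-partition S h m c , partition-head (hapIntervals-partition S h m c)
  columns-preserve {c} 1≤c c≤h (suc n) =
    subst (LoopInvariant m (suc (suc n)) ∘ at c)
          (sym (trans (cong (foldl sweep (initState S h m)) (range1-suc n)) (foldl-∷ʳ sweep _ (suc n) (range1 n))))
          (column-preserves (range1 h) _ (PA-occurs-once S h (suc n) 1≤c c≤h) (columns-preserve 1≤c c≤h n))
    where
    sweep : State → ℕ → State
    sweep st j = foldl (step S h d j) st (range1 h)

  RSfinal-partition : 1 ≤ c → c ≤ h → Partition 1 m (RSfinal S h m d c)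
  RSfinal-partition 1≤c c≤h = invariant-final (columns-preserve 1≤c c≤h m)

lemma16 : (h m : ℕ) (S : Haplotypes) (j i κ : ℕ) →
    1 ≤ j → j ≤ m → 1 ≤ i → i ≤ h →
    1 ≤ phiIter S h j κ i →
    1 ≤ phiIter S h j (suc κ) i →
    (ℓ b e : ℕ) →
    nth1 (RSfinal S h m 2 (phiIter S h j κ i)) ℓ ≡ just (b , e) →
    b ≤ j → j ≤ e →
    (x : ℕ) →
    occPos (phiIter S h j κ i) ℓ (Iarray S h m 2) ≡ just x →
    (Σ Interval λ seg →
        nth1 (RSfinal S h m 2 (phiIter S h j (suc κ) i))
             (rank (phiIter S h j (suc κ) i) (Iarray S h m 2) x) ≡ just seg
        × proj₁ seg ≤ e × e ≤ proj₂ seg)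
    ⊎
    (Σ Interval λ seg →
        nth1 (RSfinal S h m 2 (phiIter S h j (suc κ) i))
             (suc (rank (phiIter S h j (suc κ) i) (Iarray S h m 2) x)) ≡ just seg
        × proj₁ seg ≤ e × e ≤ proj₂ seg)
lemma16 h m S j i κ 1≤j _ _ i≤h 1≤c 1≤c' ℓ b e seg≡ _ j≤e x occ≡ =
  endpointArray-rank h (RSfinal S h m 2) 1≤c c≤h 1≤c' c'≤h
    (RSfinal-partition S h m 2 1≤c c≤h) (RSfinal-partition S h m 2 1≤c' c'≤h)
    seg≡ 1≤e occ≡
  where
  c≤h : phiIter S h j κ i ≤ h
  c≤h = phiIter-≤ S h j κ i≤h

  c'≤h : phiIter S h j (suc κ) i ≤ h
  c'≤h = phiIter-≤ S h j (suc κ) i≤h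

  -- the only use of the site j
  1≤e : 1 ≤ e
  1≤e = ≤-trans 1≤j j≤e
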